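{- Let $\eta,t\ge 1$ and $\zeta\ge 2$ be integers, let $G$ be a graph that does not contain $K_{t,t}$ as a subgraph, and let $(S',r)$ be a $(\zeta',\eta)$-decorated rooted tree in $G$, where $\zeta'\ge \zeta^{\eta}|S'|t^{\eta+1}$. Let $p\in V(S')$ have height in $(S',r)$ less than $\eta$. Then there is a $G$-neighbour $q$ of $p$ with $q\in V(G)\setminus V(S')$, having no other $G$-neighbour in $V(S')$, such that, if $S$ denotes the tree obtained from $S'$ by adding $q$ and the edge $pq$, then $(S,r)$ is a $(\zeta,\eta)$-decorated rooted tree in $G$.
   Context: All graphs are finite, without loops or parallel edges; a subgraph need not be induced; $|S'|$ is the number of vertices of $S'$; $K_{t,t}$ is the complete bipartite graph with both parts of size $t$. A rooted tree $(T,r)$ is a tree $T$ with a distinguished vertex $r$. A rooted subtree of $(T,r)$ is $(J,r)$ with $J$ a subtree of $T$ containing $r$. The height of a vertex $v$ in $(T,r)$ is the number of edges of the path between $v$ and $r$; the height of $(T,r)$ is the maximum height of its vertices. If $u,v$ are adjacent and $u$ lies on the path between $v$ and $r$, then $v$ is a child of $u$. For integers $z\ge 1,k\ge 0$, $(T,r)$ is $(z,k)$-uniform if every vertex with a child has exactly $z$ children and every vertex with no child is joined to $r$ by a path of length exactly $k$. If $T$ is a subgraph of $G$, $(T,r)$ is a path-induced rooted subgraph of $G$ if every path of $T$ with one end $r$ is an induced subgraph of $G$. If $(S,r)$ is a rooted subtree of $(T,r)$, deleting the edges of $S$ from $T$ leaves components each containing exactly one vertex of $S$; for $v\in V(S)$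 let $T_v$ be the one containing $v$; $(T_v,v)$ is the decoration of $S$ at $v$ in $T$. A rooted tree $(S,r)$ is $(\zeta,\eta)$-decorated in $G$ if $S$ is an induced subgraph of $G$ with height at most $\eta$, and there is a rooted tree $(T,r)$ such that: $(S,r)$ is a rooted subtree of $(T,r)$ and $(T,r)$ is a path-induced rooted subgraph of $G$; for every $u\in V(S)$ and $v\in V(T)\setminus V(S)$, if $u,v$ are $G$-adjacent then they are $T$-adjacent; and for each $v\in V(S)$ the decoration of $S$ at $v$ in $T$ is $(\zeta,\eta-h)$-uniform, where $h$ is the height of $v$ in $(S,r)$. -}

module Defs where

open import Data.Nat using (ℕ; zero; suc; _+_; _≤_; _∸_)
open import Data.Fin using (Fin; _≟_)
open import Data.Fin.Base using () renaming (zero to fzero; suc to fsuc)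
open import Data.Bool using (Bool; true; false; T; _∧_; _∨_; not; if_then_else_)
open import Data.Product using (Σ; ∃; ∃-syntax; _×_; _,_)
open import Data.Sum using (_⊎_)
open import Data.Empty using (⊥)
open import Relation.Nullary using (¬_; Dec)
open import Relation.Nullary.Decidable using (⌊_⌋)
open import Relation.Binary.PropositionalEquality using (_≡_; _≢_)

record Graph : Set₁ where
  field
    n      : ℕ
    Adj    : Fin n → Fin n → Set
    adj?   : ∀ u v → Dec (Adj u v)
    sym    : ∀ {u v} → Adj u v → Adj v u
    irrefl : ∀ {u} → ¬ Adj u u

count : ∀ {n} → (Fin n → Bool) → ℕ
count {zero}  f = 0
count {suc n} f = (if f fzero then 1 else 0) + count (λ i → f (fsuc i))

ContainsKtt : Graph → ℕ → Set
ContainsKtt G t =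
  Σ (Fin t → V) λ a → Σ (Fin t → V) λ b →
    (∀ i j → a i ≡ a j → i ≡ j) ×
    (∀ i j → b i ≡ b j → i ≡ j) ×
    (∀ i j → a i ≢ b j) ×
    (∀ i j → Adj (a i) (b j))
  where open Graph G
        V = Fin n

module _ (G : Graph) where
  open Graph G

  V : Set
  V = Fin n

  -- Data of a rooted tree in G, in parent-pointer form: a root, a vertex
  -- set (boolean membership) and a parent map (only meaningful on
  -- non-root members).  The edges of the tree are {v, par v} for
  -- non-root members v.
  record RData : Set where
    constructor mkR
    field
      root : V
      mem  : V → Bool
      par  : V → V

  open RData public

  In : RData → V → Set
  In D v = T (mem D v)

  data Ht (D : RData) : V → ℕ → Set where
    h0 : Ht D (root D) 0
    hs : ∀ {v h} → v ≢ root D → In D v → Ht D (par D v) h → Ht D v (suc h)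

  IsRTree : RData → Set
  IsRTree D =
    In D (root D) ×
    (∀ v → In D v → ∃[ h ] Ht D v h) ×
    (∀ v → In D v → v ≢ root D → Adj v (par D v))

  TEdge : RData → V → V → Set
  TEdge D u v =
    (In D u × u ≢ root D × par D u ≡ v) ⊎ (In D v × v ≢ root D × par D v ≡ u)

  size : RData → ℕ
  size D = count (mem D)

  Induced : RData → Set
  Induced D = ∀ u v → In D u → In D v → Adj u v → TEdge D u v

  HeightAtMost : RData → ℕ → Set
  HeightAtMost D η = ∀ v h → In D v → Ht D v h → h ≤ η

  data Anc (D : RData) (a : V) : V → Set where
    here : Anc D a a
    up   : ∀ {w} → In D w → w ≢ root D → Anc D a (par D w) → Anc D a w

  -- every path of the tree with one end the root is induced in G
  PathInduced : RData → Set
  PathInduced D = ∀ w a b → In D w → Anc D a w → Anc D b w → Adj a b → TEdge D a b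

  Subtree : RData → RData → Set
  Subtree S Tr =
    root S ≡ root Tr ×
    (∀ v → In S v → In Tr v) ×
    (∀ v → In S v → v ≢ root S → par S v ≡ par Tr v)

  -- DHt S Tr v w h : w is a vertex of the decoration (Tr_v, v) of S at v,
  -- at height h in (Tr_v, v)
  data DHt (S Tr : RData) (v : V) : V → ℕ → Set where
    d0 : DHt S Tr v v 0
    ds : ∀ {w h} → In Tr w → ¬ In S w → w ≢ root Tr →
         DHt S Tr v (par Tr w) h → DHt S Tr v w (suc h)

  decChildren : RData → RData → V → ℕ
  decChildren S Tr u =
    count (λ w → mem Tr w ∧ not (mem S w) ∧ not ⌊ w ≟ root Tr ⌋ ∧ ⌊ par Tr w ≟ u ⌋)

  DecUniform : RData → RData → V → ℕ → ℕ → Set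
  DecUniform S Tr v z k =
    ∀ u h → DHt S Tr v u h →
      (decChildren S Tr u ≢ 0 → decChildren S Tr u ≡ z) ×
      (decChildren S Tr u ≡ 0 → h ≡ k)

  Decorated : ℕ → ℕ → RData → Set
  Decorated ζ η S =
    IsRTree S × Induced S × HeightAtMost S η ×
    Σ RData λ Tr →
      IsRTree Tr × Subtree S Tr × PathInduced Tr ×
      (∀ u v → In S u → In Tr v → ¬ In S v → Adj u v → TEdge Tr u v) ×
      (∀ v h → In S v → Ht S v h → DecUniform S Tr v ζ (η ∸ h))

  extend : RData → V → V → RData
  extend D p q = mkR (root D)
                     (λ w → mem D w ∨ ⌊ w ≟ q ⌋)
                     (λ w → if ⌊ w ≟ q ⌋ then p else par D w)

-- Every vertex of the decoration tree Tr below height η has exactly ζ' children outside S'.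
-- Fix a candidate q among the children of p. A vertex is d-bad if it is q, is adjacent to q,
-- or is (d-1)-overloaded; a vertex is d-overloaded if more than ζ' - ζ of its children are
-- d-bad, i.e. if fewer than ζ good children remain. If no vertex of S' is overloaded, pruning
-- Tr to ζ good children per vertex (and to any ζ children below q, where path-inducedness of
-- Tr controls the edges at q) yields a (ζ, η)-decoration of S' + pq.
-- With L = ζ t, fewer than L^(d+1) candidates make a given vertex d-overloaded: those with at
-- least ε overloaded children are few by double counting against the bound one level down,
-- and fewer than t remain otherwise, since t of them would have t common neighbours among the
-- ζ' children, giving a K_{t,t}; ε is chosen with t (ζ + ε) ≤ ζ' ≤ ε L. Summing over S',
-- fewer than |S'| L^η ≤ ζ' candidates are spoilt, so some child of p is not.

module Submission where

open import Defs
open import Data.Bool using (Bool; true; false; T; _∧_; _∨_; not; if_then_else_)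
open import Data.Bool.Properties using (T-∧; T-∨; T-≡; ∧-assoc; ∧-comm; ∧-zeroʳ; ∧-identityʳ)
open import Data.Empty using (⊥-elim)
open import Data.Fin using (Fin; toℕ; _≟_) renaming (zero to fzero; suc to fsuc)
open import Data.Nat hiding (_≟_)
open import Data.Nat.DivMod using (_/_; _%_; m/n*n≤m; m≡m%n+[m/n]*n; m%n<n)
open import Data.Nat.Properties hiding (_≟_)
open import Algebra.Properties.Semiring.Sum +-*-semiring using (sum; ∑-comm; *-distribʳ-sum)
open import Data.Nat.Solver using (module +-*-Solver)
open import Data.Product using (Σ; ∃; _×_; _,_; proj₁; proj₂)
open import Data.Sum using (_⊎_; inj₁; inj₂)
open import Data.Unit using (tt)
open import Function.Bundles using (Equivalence)
open import Relation.Binary.PropositionalEquality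
open import Relation.Nullary using (¬_; yes; no; contradiction)
open import Relation.Nullary.Decidable using (⌊_⌋; toWitness; fromWitness; toWitnessFalse; fromWitnessFalse)

open Equivalence using (to; from)
open +-*-Solver using (solve; _:+_; _:*_; _:=_; con)

∧-intro : ∀ {x y} → T x → T y → T (x ∧ y)
∧-intro Tx Ty = from T-∧ (Tx , Ty)

∧-elimˡ : ∀ x {y} → T (x ∧ y) → T x
∧-elimˡ x Tx∧y = proj₁ (to (T-∧ {x}) Tx∧y)

∧-elimʳ : ∀ x {y} → T (x ∧ y) → T y
∧-elimʳ x Tx∧y = proj₂ (to (T-∧ {x}) Tx∧y)

∨-introˡ : ∀ {x} y → T x → T (x ∨ y)
∨-introˡ y Tx = from T-∨ (inj₁ Tx)

∨-introʳ : ∀ x {y} → T y → T (x ∨ y)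
∨-introʳ x Ty = from (T-∨ {x}) (inj₂ Ty)

∨-elim : ∀ x {y} → T (x ∨ y) → T x ⊎ T y
∨-elim x = to (T-∨ {x})

T-not⇒¬T : ∀ {x} → T (not x) → ¬ T x
T-not⇒¬T {false} _ ()

¬T⇒T-not : ∀ {x} → ¬ T x → T (not x)
¬T⇒T-not {true}  ¬Tx = ¬Tx tt
¬T⇒T-not {false} _   = tt

T⇔T⇒≡ : ∀ {x y} → (T x → T y) → (T y → T x) → x ≡ y
T⇔T⇒≡ {true}  {true}  _   _   = refl
T⇔T⇒≡ {true}  {false} x⇒y _   = ⊥-elim (x⇒y tt)
T⇔T⇒≡ {false} {true}  _   y⇒x = ⊥-elim (y⇒x tt)
T⇔T⇒≡ {false} {false} _   _   = refl

indicator : Bool → ℕ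
indicator b = if b then 1 else 0

indicator≤1 : ∀ b → indicator b ≤ 1
indicator≤1 true  = ≤-refl
indicator≤1 false = z≤n

count-cong : ∀ {n} {f g : Fin n → Bool} → (∀ i → f i ≡ g i) → count f ≡ count g
count-cong {zero}  f≗g = refl
count-cong {suc n} {f} {g} f≗g =
  cong₂ _+_ (cong indicator (f≗g fzero)) (count-cong {f = λ i → f (fsuc i)} {g = λ i → g (fsuc i)} (λ i → f≗g (fsuc i)))

count-none : ∀ {n} (f : Fin n → Bool) → (∀ i → ¬ T (f i)) → count f ≡ 0
count-none {zero}  f none = refl
count-none {suc n} f none with f fzero in f0
... | true  = ⊥-elim (none fzero (subst T (sym f0) tt))
... | false = count-none (λ i → f (fsuc i)) (λ i → none (fsuc i))

count-∧-false : ∀ {n} (f : Fin n → Bool) → count (λ i → f i ∧ false) ≡ 0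
count-∧-false f = count-none _ (λ i fi∧false → subst T (∧-zeroʳ (f i)) fi∧false)

count-split : ∀ {n} (f g : Fin n → Bool) →
  count f ≡ count (λ i → f i ∧ g i) + count (λ i → f i ∧ not (g i))
count-split {zero}  f g = refl
count-split {suc n} f g with f fzero | g fzero | count-split (λ i → f (fsuc i)) (λ i → g (fsuc i))
... | true  | true  | ih = cong suc ih
... | true  | false | ih = trans (cong suc ih) (sym (+-suc _ _))
... | false | _     | ih = ih

count-mono : ∀ {n} {f g : Fin n → Bool} → (∀ i → T (f i) → T (g i)) → count f ≤ count g
count-mono {zero}          f⊆g = z≤n
count-mono {suc n} {f} {g} f⊆g with f fzero | g fzero | f⊆g fzero
  | count-mono {f = λ i → f (fsuc i)} {g = λ i → g (fsuc i)} (λ i → f⊆g (fsuc i))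
... | true  | true  | _    | ih = s≤s ih
... | true  | false | f0⊆g | ih = ⊥-elim (f0⊆g tt)
... | false | true  | _    | ih = m≤n⇒m≤1+n ih
... | false | false | _    | ih = ih

count-∧-∨ : ∀ {n} (f g h : Fin n → Bool) →
  count (λ i → f i ∧ (g i ∨ h i)) ≤ count (λ i → f i ∧ g i) + count (λ i → f i ∧ h i)
count-∧-∨ {zero}  f g h = z≤n
count-∧-∨ {suc n} f g h with f fzero | g fzero | h fzero
  | count-∧-∨ (λ i → f (fsuc i)) (λ i → g (fsuc i)) (λ i → h (fsuc i))
... | false | _     | _     | ih = ih
... | true  | true  | true  | ih = s≤s (≤-trans ih (≤-trans (m≤n+m _ 1) (≤-reflexive (sym (+-suc _ _)))))
... | true  | true  | false | ih = s≤s ih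
... | true  | false | true  | ih = ≤-trans (s≤s ih) (≤-reflexive (sym (+-suc _ _)))
... | true  | false | false | ih = ih

count>0⇒∃ : ∀ {n} (f : Fin n → Bool) → 0 < count f → ∃ λ i → T (f i)
count>0⇒∃ {suc n} f pos with f fzero in f0
... | true  = fzero , subst T (sym f0) tt
... | false with count>0⇒∃ (λ i → f (fsuc i)) pos
...   | i , fi = fsuc i , fi

⌊≟⌋-fsuc : ∀ {n} (i j : Fin n) → ⌊ fsuc i ≟ fsuc j ⌋ ≡ ⌊ i ≟ j ⌋
⌊≟⌋-fsuc i j with i ≟ j
... | yes _ = refl
... | no  _ = refl

count-singleton : ∀ {n} (f : Fin n → Bool) (i : Fin n) →
  count (λ j → f j ∧ ⌊ j ≟ i ⌋) ≡ indicator (f i)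
count-singleton {suc n} f fzero with f fzero
... | true  = cong suc (count-∧-false (λ j → f (fsuc j)))
... | false = count-∧-false (λ j → f (fsuc j))
count-singleton {suc n} f (fsuc i) =
  cong₂ _+_ (cong indicator (∧-zeroʳ (f fzero)))
    (trans (count-cong (λ j → cong (f (fsuc j) ∧_) (⌊≟⌋-fsuc j i))) (count-singleton (λ j → f (fsuc j)) i))

count-remove : ∀ {n} (f : Fin n → Bool) (i : Fin n) → T (f i) →
  count f ≡ suc (count (λ j → f j ∧ not ⌊ j ≟ i ⌋))
count-remove f i fi = trans (count-split f (λ j → ⌊ j ≟ i ⌋))
  (cong (_+ count (λ j → f j ∧ not ⌊ j ≟ i ⌋)) (trans (count-singleton f i) (cong indicator (to T-≡ fi))))

∃⇒count>0 : ∀ {n} (f : Fin n → Bool) (i : Fin n) → T (f i) → 0 < count f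
∃⇒count>0 f i fi = subst (0 <_) (sym (count-remove f i fi)) z<s

count≡sum : ∀ {n} (f : Fin n → Bool) → count f ≡ sum (λ i → indicator (f i))
count≡sum {zero}  f = refl
count≡sum {suc n} f = cong (indicator (f fzero) +_) (count≡sum (λ i → f (fsuc i)))

sum-mono-≤ : ∀ {n} {u v : Fin n → ℕ} → (∀ i → u i ≤ v i) → sum u ≤ sum v
sum-mono-≤ {zero}  u≤v = z≤n
sum-mono-≤ {suc n} u≤v = +-mono-≤ (u≤v fzero) (sum-mono-≤ (λ i → u≤v (fsuc i)))

double-counting : ∀ {m n} (R : Fin m → Fin n → Bool) (A : Fin m → Bool) (B : Fin n → Bool) {a b : ℕ} →
  (∀ i → T (A i) → a ≤ count (R i)) →
  (∀ j → T (B j) → count (λ i → R i j) ≤ b) →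
  (∀ i j → T (R i j) → T (B j)) →
  count A * a ≤ count B * b
double-counting {m} {n} R A B {a} {b} rowsA colsB R⊆B = begin
  count A * a                                       ≡⟨ cong (_* a) (count≡sum A) ⟩
  sum (λ i → indicator (A i)) * a                   ≡⟨ *-distribʳ-sum a (λ i → indicator (A i)) ⟩
  sum (λ i → indicator (A i) * a)                   ≤⟨ sum-mono-≤ row ⟩
  sum (λ i → sum (λ j → indicator (R i j)))         ≡⟨ ∑-comm (λ i j → indicator (R i j)) ⟩
  sum (λ j → sum (λ i → indicator (R i j)))         ≤⟨ sum-mono-≤ column ⟩
  sum (λ j → indicator (B j) * b)                   ≡⟨ *-distribʳ-sum b (λ j → indicator (B j)) ⟨
  sum (λ j → indicator (B j)) * b                   ≡⟨ cong (_* b) (count≡sum B) ⟨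
  count B * b                                       ∎
  where
  open ≤-Reasoning
  row : ∀ i → indicator (A i) * a ≤ sum (λ j → indicator (R i j))
  row i with A i in Ai
  ... | false = z≤n
  ... | true  = ≤-trans (≤-reflexive (+-identityʳ a))
                  (≤-trans (rowsA i (subst T (sym Ai) tt)) (≤-reflexive (count≡sum (R i))))
  column : ∀ j → sum (λ i → indicator (R i j)) ≤ indicator (B j) * b
  column j with B j in Bj
  ... | true  = ≤-trans (≤-reflexive (sym (count≡sum (λ i → R i j))))
                  (≤-trans (colsB j (subst T (sym Bj) tt)) (≤-reflexive (sym (+-identityʳ b))))
  ... | false = ≤-trans (≤-reflexive (sym (count≡sum (λ i → R i j))))
                  (≤-trans (count-mono {g = λ _ → false} (λ i Rij → subst T Bj (R⊆B i j Rij)))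
                           (≤-reflexive (count-none {m} (λ _ → false) (λ _ ()))))

distinct-witnesses : ∀ {n} (k : ℕ) (f : Fin n → Bool) → k ≤ count f →
  Σ (Fin k → Fin n) λ a → (∀ i j → a i ≡ a j → i ≡ j) × (∀ i → T (f (a i)))
distinct-witnesses zero    f _ = (λ ()) , (λ ()) , (λ ())
distinct-witnesses (suc k) f k<count with count>0⇒∃ f (≤-trans z<s k<count)
... | i , fi with distinct-witnesses k (λ j → f j ∧ not ⌊ j ≟ i ⌋)
                    (≤-pred (≤-trans k<count (≤-reflexive (count-remove f i fi))))
...   | a , a-injective , fa = b , b-injective , fb
  where
  a≢i : ∀ m → a m ≢ i
  a≢i m = toWitnessFalse (∧-elimʳ (f (a m)) (fa m))
  b : Fin (suc k) → _
  b fzero    = i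
  b (fsuc m) = a m
  b-injective : ∀ x y → b x ≡ b y → x ≡ y
  b-injective fzero    fzero    _   = refl
  b-injective fzero    (fsuc y) i≡ay = ⊥-elim (a≢i y (sym i≡ay))
  b-injective (fsuc x) fzero    ax≡i = ⊥-elim (a≢i x ax≡i)
  b-injective (fsuc x) (fsuc y) ax≡ay = cong fsuc (a-injective x y ax≡ay)
  fb : ∀ x → T (f (b x))
  fb fzero    = fi
  fb (fsuc m) = ∧-elimˡ (f (a m)) (fa m)

allᵇ : ∀ {t} → (Fin t → Bool) → Bool
allᵇ {zero}  g = true
allᵇ {suc t} g = g fzero ∧ allᵇ (λ i → g (fsuc i))

T-allᵇ : ∀ {t} (g : Fin t → Bool) → T (allᵇ g) → ∀ i → T (g i)
T-allᵇ g all-g fzero    = ∧-elimˡ (g fzero) all-g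
T-allᵇ g all-g (fsuc i) = T-allᵇ (λ i → g (fsuc i)) (∧-elimʳ (g fzero) all-g) i

count-common : ∀ {t n} (C : Fin n → Bool) (g : Fin t → Fin n → Bool) {k : ℕ} →
  (∀ i → count (λ c → C c ∧ not (g i c)) ≤ k) →
  count C ≤ count (λ c → C c ∧ allᵇ (λ i → g i c)) + t * k
count-common {zero} C g misses = ≤-trans (≤-reflexive (count-cong (λ c → sym (∧-identityʳ (C c))))) (m≤m+n _ 0)
count-common {suc t} {n} C g {k} misses = begin
  count C                                                ≤⟨ count-common C (λ i → g (fsuc i)) (λ i → misses (fsuc i)) ⟩
  count R + t * k                                        ≡⟨ cong (_+ t * k) (count-split R (g fzero)) ⟩
  count (λ c → R c ∧ g fzero c) + count (λ c → R c ∧ not (g fzero c)) + t * k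
    ≤⟨ +-monoˡ-≤ (t * k) (+-mono-≤ (≤-reflexive all-g) (≤-trans misses-R (misses fzero))) ⟩
  count (λ c → C c ∧ allᵇ (λ i → g i c)) + k + t * k     ≡⟨ +-assoc _ k (t * k) ⟩
  count (λ c → C c ∧ allᵇ (λ i → g i c)) + suc t * k     ∎
  where
  open ≤-Reasoning
  R : Fin n → Bool
  R c = C c ∧ allᵇ (λ i → g (fsuc i) c)
  all-g : count (λ c → R c ∧ g fzero c) ≡ count (λ c → C c ∧ allᵇ (λ i → g i c))
  all-g = count-cong (λ c → trans (∧-assoc (C c) _ _) (cong (C c ∧_) (∧-comm _ (g fzero c))))
  misses-R : count (λ c → R c ∧ not (g fzero c)) ≤ count (λ c → C c ∧ not (g fzero c))
  misses-R = count-mono {f = λ c → R c ∧ not (g fzero c)} (λ c Rc∧¬g →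
    ∧-intro {C c} (∧-elimˡ (C c) (∧-elimˡ (R c) Rc∧¬g)) (∧-elimʳ (R c) Rc∧¬g))

rank : ∀ {n} → (Fin n → Bool) → Fin n → ℕ
rank f i = count (λ j → f j ∧ (toℕ j <ᵇ toℕ i))

rank-fzero : ∀ {n} (f : Fin (suc n) → Bool) → rank f fzero ≡ 0
rank-fzero f = count-∧-false f

rank-fsuc : ∀ {n} (f : Fin (suc n) → Bool) (i : Fin n) →
  rank f (fsuc i) ≡ indicator (f fzero) + rank (λ j → f (fsuc j)) i
rank-fsuc f i = cong (λ b → indicator b + rank (λ j → f (fsuc j)) i) (∧-identityʳ (f fzero))

count-rank< : ∀ {n} (f : Fin n → Bool) (z : ℕ) → count (λ i → f i ∧ (rank f i <ᵇ z)) ≡ z ⊓ count f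
count-rank< {zero}  f z       = sym (⊓-zeroʳ z)
count-rank< {suc n} f zero    = count-∧-false f
count-rank< {suc n} f (suc z) = by-first (f fzero) refl
  where
  open ≡-Reasoning
  f' = λ j → f (fsuc j)
  rest : ∀ {b} → f fzero ≡ b →
    count (λ i → f' i ∧ (rank f (fsuc i) <ᵇ suc z)) ≡ count (λ i → f' i ∧ (indicator b + rank f' i <ᵇ suc z))
  rest f0 = count-cong (λ i → cong (λ r → f' i ∧ (r <ᵇ suc z))
    (trans (rank-fsuc f i) (cong (λ b → indicator b + rank f' i) f0)))
  by-first : ∀ b → f fzero ≡ b → count (λ i → f i ∧ (rank f i <ᵇ suc z)) ≡ suc z ⊓ count f
  by-first false f0 = begin
    indicator (f fzero ∧ (rank f fzero <ᵇ suc z)) + count (λ i → f' i ∧ (rank f (fsuc i) <ᵇ suc z))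
      ≡⟨ cong₂ _+_ (cong (λ b → indicator (b ∧ (rank f fzero <ᵇ suc z))) f0) (rest f0) ⟩
    count (λ i → f' i ∧ (rank f' i <ᵇ suc z))
      ≡⟨ count-rank< f' (suc z) ⟩
    suc z ⊓ count f'
      ≡⟨ cong (λ b → suc z ⊓ (indicator b + count f')) f0 ⟨
    suc z ⊓ count f ∎
  by-first true f0 = begin
    indicator (f fzero ∧ (rank f fzero <ᵇ suc z)) + count (λ i → f' i ∧ (rank f (fsuc i) <ᵇ suc z))
      ≡⟨ cong₂ _+_ (cong₂ (λ b r → indicator (b ∧ (r <ᵇ suc z))) f0 (rank-fzero f)) (rest f0) ⟩
    suc (count (λ i → f' i ∧ (rank f' i <ᵇ z)))
      ≡⟨ cong suc (count-rank< f' z) ⟩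
    suc z ⊓ suc (count f')
      ≡⟨ cong (λ b → suc z ⊓ (indicator b + count f')) f0 ⟨
    suc z ⊓ count f ∎

^-distrib-* : ∀ m n o → (m * n) ^ o ≡ m ^ o * n ^ o
^-distrib-* m n zero    = refl
^-distrib-* m n (suc o) = trans (cong (m * n *_) (^-distrib-* m n o))
  (solve 4 (λ m n x y → m :* n :* (x :* y) := m :* x :* (n :* y)) refl m n (m ^ o) (n ^ o))

1≤m^n : ∀ {m} n → 1 ≤ m → 1 ≤ m ^ n
1≤m^n {suc m} n _ = m^n>0 (suc m) n

pred[n]<n : ∀ {n} → 1 ≤ n → pred n < n
pred[n]<n {suc n} _ = n<1+n n

^-monoʳ-≤′ : ∀ {m a b} → 1 ≤ m → a ≤ b → m ^ a ≤ m ^ b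
^-monoʳ-≤′ {suc m} _ a≤b = ^-monoʳ-≤ (suc m) a≤b

small-slack : ∀ {ζ t} → 1 ≤ ζ → 2 ≤ t → t * (ζ + 1) ≤ ζ ^ 1 * t ^ 2
small-slack {ζ} {t} 1≤ζ 2≤t = begin
  t * (ζ + 1)         ≤⟨ *-monoʳ-≤ t (+-monoʳ-≤ ζ 1≤ζ) ⟩
  t * (ζ + ζ)         ≡⟨ cong (t *_) (solve 1 (λ ζ → ζ :+ ζ := ζ :* con 2) refl ζ) ⟩
  t * (ζ * 2)         ≤⟨ *-monoʳ-≤ t (*-monoʳ-≤ ζ 2≤t) ⟩
  t * (ζ * t)         ≡⟨ solve 2 (λ ζ t → t :* (ζ :* t) := ζ :* con 1 :* (t :* (t :* con 1))) refl ζ t ⟩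
  ζ ^ 1 * t ^ 2       ∎
  where open ≤-Reasoning

m≤[1+m/n]*n : ∀ m n .{{_ : NonZero n}} → m ≤ suc (m / n) * n
m≤[1+m/n]*n m n = begin
  m                 ≡⟨ m≡m%n+[m/n]*n m n ⟩
  m % n + m / n * n ≤⟨ +-monoˡ-≤ (m / n * n) (<⇒≤ (m%n<n m n)) ⟩
  n + m / n * n     ∎
  where open ≤-Reasoning

large-slack : ∀ {ζ t ζ'} .{{_ : NonZero (ζ * t)}} → 2 ≤ ζ → 2 ≤ t → ζ ^ 2 * t ^ 3 ≤ ζ' →
  t * (ζ + suc (ζ' / (ζ * t))) ≤ ζ'
large-slack {ζ} {t} {ζ'} 2≤ζ 2≤t bound = *-cancelˡ-≤ 2 (begin
  2 * (t * (ζ + suc k))           ≡⟨ solve 3 (λ ζ t k → con 2 :* (t :* (ζ :+ (con 1 :+ k)))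
                                                  := con 2 :* (t :* (ζ :+ con 1)) :+ con 2 :* (t :* k)) refl ζ t k ⟩
  2 * (t * (ζ + 1)) + 2 * (t * k) ≤⟨ +-mono-≤ 2t[ζ+1]≤ζ' 2tk≤ζ' ⟩
  ζ' + ζ'                         ≡⟨ solve 1 (λ x → x :+ x := con 2 :* x) refl ζ' ⟩
  2 * ζ'                          ∎)
  where
  open ≤-Reasoning
  k = ζ' / (ζ * t)
  2t[ζ+1]≤ζ' : 2 * (t * (ζ + 1)) ≤ ζ'
  2t[ζ+1]≤ζ' = begin
    2 * (t * (ζ + 1))          ≤⟨ *-monoʳ-≤ 2 (*-monoʳ-≤ t (+-monoʳ-≤ ζ (≤-trans (s≤s z≤n) 2≤ζ))) ⟩
    2 * (t * (ζ + ζ))          ≡⟨ solve 2 (λ ζ t → con 2 :* (t :* (ζ :+ ζ)) := con 2 :* con 2 :* (ζ :* t)) refl ζ t ⟩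
    2 * 2 * (ζ * t)            ≤⟨ *-monoˡ-≤ (ζ * t) (*-mono-≤ 2≤ζ (*-mono-≤ 2≤t (≤-trans (s≤s z≤n) 2≤t))) ⟩
    ζ * (t * t) * (ζ * t)      ≡⟨ solve 2 (λ ζ t → ζ :* (t :* t) :* (ζ :* t)
                                                   := ζ :* (ζ :* con 1) :* (t :* (t :* (t :* con 1)))) refl ζ t ⟩
    ζ ^ 2 * t ^ 3              ≤⟨ bound ⟩
    ζ'                         ∎
  2tk≤ζ' : 2 * (t * k) ≤ ζ'
  2tk≤ζ' = begin
    2 * (t * k)     ≤⟨ *-monoˡ-≤ (t * k) 2≤ζ ⟩
    ζ * (t * k)     ≡⟨ solve 3 (λ ζ t k → ζ :* (t :* k) := k :* (ζ :* t)) refl ζ t k ⟩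
    k * (ζ * t)     ≤⟨ m/n*n≤m ζ' (ζ * t) ⟩
    ζ'              ∎

module ParameterBounds {ζ t s ζ' η : ℕ} (2≤ζ : 2 ≤ ζ) (1≤t : 1 ≤ t) (1≤s : 1 ≤ s) (1≤η : 1 ≤ η)
  (bound : ζ ^ η * s * t ^ (η + 1) ≤ ζ') where

  1≤ζ : 1 ≤ ζ
  1≤ζ = ≤-trans (s≤s z≤n) 2≤ζ

  monomial≤ζ' : ∀ {a b} → a ≤ η → b ≤ η + 1 → ζ ^ a * t ^ b ≤ ζ'
  monomial≤ζ' {a} {b} a≤η b≤η+1 = begin
    ζ ^ a * t ^ b     ≡⟨ cong (_* t ^ b) (*-identityʳ (ζ ^ a)) ⟨
    ζ ^ a * 1 * t ^ b ≤⟨ *-mono-≤ (*-mono-≤ (^-monoʳ-≤′ 1≤ζ a≤η) 1≤s) (^-monoʳ-≤′ 1≤t b≤η+1) ⟩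
    ζ ^ η * s * t ^ (η + 1) ≤⟨ bound ⟩
    ζ'                ∎
    where open ≤-Reasoning

  1≤ζ' : 1 ≤ ζ'
  1≤ζ' = monomial≤ζ' z≤n z≤n

  ζ≤ζ' : ζ ≤ ζ'
  ζ≤ζ' = ≤-trans (≤-reflexive (solve 1 (λ ζ → ζ := ζ :* con 1 :* con 1) refl ζ)) (monomial≤ζ' 1≤η z≤n)

  L : ℕ
  L = ζ * t

  t≤L : t ≤ L
  t≤L = ≤-trans (≤-reflexive (sym (*-identityˡ t))) (*-monoˡ-≤ t 1≤ζ)

  instance
    L-nonZero : NonZero L
    L-nonZero = >-nonZero (≤-trans 1≤t t≤L)

  s*L^η≤ζ' : s * L ^ η ≤ ζ'
  s*L^η≤ζ' = begin
    s * L ^ η               ≡⟨ cong (s *_) (^-distrib-* ζ t η) ⟩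
    s * (ζ ^ η * t ^ η)     ≡⟨ solve 3 (λ s x y → s :* (x :* y) := x :* s :* y) refl s (ζ ^ η) (t ^ η) ⟩
    ζ ^ η * s * t ^ η       ≤⟨ *-monoʳ-≤ (ζ ^ η * s) (^-monoʳ-≤′ 1≤t (m≤m+n η 1)) ⟩
    ζ ^ η * s * t ^ (η + 1) ≤⟨ bound ⟩
    ζ'                      ∎
    where open ≤-Reasoning

  record Slack : Set where
    field
      ε         : ℕ
      1≤ε       : 1 ≤ ε
      t[ζ+ε]≤ζ' : t * (ζ + ε) ≤ ζ'
      ζ'≤εL     : 2 ≤ η → ζ' ≤ ε * L

  slack : 2 ≤ t → Slack
  slack 2≤t with 2 ≤? η
  ... | yes 2≤η = record
    { ε = suc (ζ' / L) ; 1≤ε = s≤s z≤n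
    ; t[ζ+ε]≤ζ' = large-slack 2≤ζ 2≤t (monomial≤ζ' 2≤η (+-monoˡ-≤ 1 2≤η))
    ; ζ'≤εL = λ _ → m≤[1+m/n]*n ζ' L
    }
  ... | no η≱2 = record
    { ε = 1 ; 1≤ε = ≤-refl
    ; t[ζ+ε]≤ζ' = ≤-trans (small-slack 1≤ζ 2≤t) (monomial≤ζ' 1≤η (+-monoˡ-≤ 1 1≤η))
    ; ζ'≤εL = λ 2≤η → contradiction 2≤η η≱2
    }

module _ {G : Graph} where

  Ht-In : ∀ {D v h} → In G D (root D) → Ht G D v h → In G D v
  Ht-In r∈D h0         = r∈D
  Ht-In _   (hs _ v∈D _) = v∈D

  Ht-unique : ∀ {D v h₁ h₂} → Ht G D v h₁ → Ht G D v h₂ → h₁ ≡ h₂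
  Ht-unique h0           h0           = refl
  Ht-unique h0           (hs r≢r _ _) = ⊥-elim (r≢r refl)
  Ht-unique (hs r≢r _ _) h0           = ⊥-elim (r≢r refl)
  Ht-unique (hs _ _ H₁)  (hs _ _ H₂)  = cong suc (Ht-unique H₁ H₂)

  Ht-parent : ∀ {D v h} → v ≢ root D → Ht G D v h → Σ ℕ λ h' → h ≡ suc h' × Ht G D (par D v) h'
  Ht-parent v≢r h0                   = ⊥-elim (v≢r refl)
  Ht-parent _   (hs {h = h'} _ _ H) = h' , refl , H

  parent-In : ∀ {D} → IsRTree G D → ∀ v → In G D v → v ≢ root D → In G D (par D v)
  parent-In (r∈D , heights , _) v v∈D v≢r with heights v v∈D
  ... | _ , H with Ht-parent v≢r H
  ...   | _ , _ , H' = Ht-In r∈D H'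

  Subtree-Ht : ∀ {A B} → Subtree G A B → ∀ {v h} → Ht G A v h → Ht G B v h
  Subtree-Ht (rA≡rB , _ , _) h0 rewrite rA≡rB = h0
  Subtree-Ht {A} {B} A⊆B@(rA≡rB , A⊆B-mem , A⊆B-par) (hs {v} v≢r v∈A H) =
    hs (λ v≡r → v≢r (trans v≡r (sym rA≡rB))) (A⊆B-mem v v∈A)
       (subst (λ x → Ht G B x _) (A⊆B-par v v∈A v≢r) (Subtree-Ht A⊆B H))

  DHt-Ht : ∀ {S Tr v u j h} → Ht G Tr v h → DHt G S Tr v u j → Ht G Tr u (h + j)
  DHt-Ht {h = h} H d0 rewrite +-identityʳ h = H
  DHt-Ht {h = h} H (ds {_} {j} u∈Tr u∉S u≢r D) rewrite +-suc h j = hs u≢r u∈Tr (DHt-Ht H D)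

edge⇒K₁₁ : ∀ {G : Graph} {a b : V G} → Graph.Adj G a b → ContainsKtt G 1
edge⇒K₁₁ {G} {a} {b} a~b = (λ _ → a) , (λ _ → b) , fin1 , fin1 , a≢b , (λ _ _ → a~b)
  where
  fin1 : ∀ {x y : V G} (i j : Fin 1) → x ≡ y → i ≡ j
  fin1 fzero fzero _ = refl
  a≢b : Fin 1 → Fin 1 → a ≢ b
  a≢b _ _ a≡b = Graph.irrefl G (subst (Graph.Adj G a) (sym a≡b) a~b)

module Decoration (G : Graph) (η ζ' : ℕ) (S' Tr : RData G)
  (S'-tree : IsRTree G S') (S'-height : HeightAtMost G S' η)
  (Tr-tree : IsRTree G Tr) (S'⊆Tr : Subtree G S' Tr)
  (uniform : ∀ v h → In G S' v → Ht G S' v h → DecUniform G S' Tr v ζ' (η ∸ h))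
  where

  r : V G
  r = root Tr

  rS'≡r : root S' ≡ r
  rS'≡r = proj₁ S'⊆Tr

  r∈S' : In G S' r
  r∈S' = subst (In G S') rS'≡r (proj₁ S'-tree)

  r∈Tr : In G Tr r
  r∈Tr = proj₁ Tr-tree

  S'⊆Tr-mem : ∀ v → In G S' v → In G Tr v
  S'⊆Tr-mem = proj₁ (proj₂ S'⊆Tr)

  -- Heights are read off the witnesses of IsRTree Tr; off the tree the value 0 is junk.
  heightOf : (x : V G) → (b : Bool) → mem Tr x ≡ b → ℕ
  heightOf x true  x∈Tr = proj₁ (proj₁ (proj₂ Tr-tree) x (subst T (sym x∈Tr) tt))
  heightOf x false _    = 0

  height : V G → ℕ
  height x = heightOf x (mem Tr x) refl

  height-Ht : ∀ {x h} → Ht G Tr x h → height x ≡ h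
  height-Ht {x} {h} H = go (mem Tr x) refl
    where
    go : ∀ b (e : mem Tr x ≡ b) → heightOf x b e ≡ h
    go true  x∈Tr = Ht-unique (proj₂ (proj₁ (proj₂ Tr-tree) x (subst T (sym x∈Tr) tt))) H
    go false x∉Tr = ⊥-elim (subst T x∉Tr (Ht-In r∈Tr H))

  Ht-height : ∀ {x} → In G Tr x → Ht G Tr x (height x)
  Ht-height {x} x∈Tr with proj₁ (proj₂ Tr-tree) x x∈Tr
  ... | h , H = subst (Ht G Tr x) (sym (height-Ht H)) H

  height-S' : ∀ {u h} → Ht G S' u h → height u ≡ h
  height-S' H = height-Ht (Subtree-Ht S'⊆Tr H)

  Ht-height-S' : ∀ {u} → In G S' u → Ht G S' u (height u)
  Ht-height-S' {u} u∈S' with proj₁ (proj₂ S'-tree) u u∈S'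
  ... | h , H = subst (Ht G S' u) (sym (height-S' H)) H

  height-S'≤η : ∀ {u} → In G S' u → height u ≤ η
  height-S'≤η u∈S' = S'-height _ _ u∈S' (Ht-height-S' u∈S')

  height-parent : ∀ {c} → In G Tr c → c ≢ r → height c ≡ suc (height (par Tr c))
  height-parent c∈Tr c≢r with Ht-parent c≢r (Ht-height c∈Tr)
  ... | _ , h≡1+h' , H = trans h≡1+h' (cong suc (sym (height-Ht H)))

  decChild : V G → V G → Bool
  decChild y c = mem Tr c ∧ not (mem S' c) ∧ not ⌊ c ≟ r ⌋ ∧ ⌊ par Tr c ≟ y ⌋

  record DecChild (y c : V G) : Set where
    field
      c∈Tr   : In G Tr c
      c∉S'   : ¬ In G S' c
      c≢r    : c ≢ r
      par≡y  : par Tr c ≡ y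

  decChild⇒ : ∀ {y c} → T (decChild y c) → DecChild y c
  decChild⇒ {y} {c} p = record
    { c∈Tr  = ∧-elimˡ (mem Tr c) p
    ; c∉S'  = T-not⇒¬T (∧-elimˡ (not (mem S' c)) rest₁)
    ; c≢r   = toWitnessFalse (∧-elimˡ (not ⌊ c ≟ r ⌋) rest₂)
    ; par≡y = toWitness (∧-elimʳ (not ⌊ c ≟ r ⌋) rest₂)
    }
    where
    rest₁ = ∧-elimʳ (mem Tr c) p
    rest₂ = ∧-elimʳ (not (mem S' c)) rest₁

  height-decChild : ∀ {y c} → T (decChild y c) → height c ≡ suc (height y)
  height-decChild p = trans (height-parent c∈Tr c≢r) (cong (λ x → suc (height x)) par≡y)
    where open DecChild (decChild⇒ p)

  decChild⇒Adj : ∀ {y c} → T (decChild y c) → Graph.Adj G c y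
  decChild⇒Adj {y} {c} child = subst (Graph.Adj G c) par≡y (proj₂ (proj₂ Tr-tree) c c∈Tr c≢r)
    where open DecChild (decChild⇒ child)

  in-decoration : ∀ {x h} → Ht G Tr x h →
    Σ (V G) λ v → Σ ℕ λ hv → Σ ℕ λ j → In G S' v × Ht G S' v hv × DHt G S' Tr v x j × hv + j ≡ h
  in-decoration h0 = r , 0 , 0 , r∈S' , subst (λ z → Ht G S' z 0) rS'≡r h0 , d0 , refl
  in-decoration {x} (hs x≢r x∈Tr H) with mem S' x in x∈S'?
  ... | true = x , height x , 0 , x∈S' , Ht-height-S' x∈S' , d0 , trans (+-identityʳ _) (height-Ht (hs x≢r x∈Tr H))
    where x∈S' = subst T (sym x∈S'?) tt
  ... | false with in-decoration H
  ...   | v , hv , j , v∈S' , Hv , D , hv+j≡h =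
          v , hv , suc j , v∈S' , Hv , ds x∈Tr (subst T x∈S'?) x≢r D , trans (+-suc hv j) (cong suc hv+j≡h)

  decChildren≡ζ' : ∀ {y} → In G Tr y → height y < η → count (decChild y) ≡ ζ'
  decChildren≡ζ' {y} y∈Tr y<η with in-decoration (Ht-height y∈Tr)
  ... | v , hv , j , v∈S' , Hv , D , hv+j≡h with uniform v hv v∈S' Hv y j D
  ...   | nonleaf , leaf with count (decChild y) Data.Nat.≟ 0
  ...     | no  ≢0 = nonleaf ≢0
  ...     | yes ≡0 = contradiction (begin
                height y          ≡⟨ hv+j≡h ⟨
                hv + j            ≡⟨ cong (hv +_) (leaf ≡0) ⟩
                hv + (η ∸ hv)     ≡⟨ m+[n∸m]≡n (S'-height v hv v∈S' Hv) ⟩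
                η                 ∎) (<⇒≢ y<η)
    where open ≡-Reasoning

  decChild-exists : ∀ {y} → In G Tr y → height y < η → 1 ≤ ζ' → ∃ λ c → T (decChild y c)
  decChild-exists y∈Tr y<η 1≤ζ' = count>0⇒∃ _ (subst (1 ≤_) (sym (decChildren≡ζ' y∈Tr y<η)) 1≤ζ')

  S'-parent≡Tr-parent : ∀ v → In G S' v → v ≢ r → par S' v ≡ par Tr v
  S'-parent≡Tr-parent v v∈S' v≢r = proj₂ (proj₂ S'⊆Tr) v v∈S' (λ v≡rS' → v≢r (trans v≡rS' rS'≡r))

  S'-parent : ∀ v → In G S' v → v ≢ r → In G S' (par Tr v)
  S'-parent v v∈S' v≢r = subst (In G S') (S'-parent≡Tr-parent v v∈S' v≢r)
    (parent-In S'-tree v v∈S' (λ v≡rS' → v≢r (trans v≡rS' rS'≡r)))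

  module Extension {p q : V G} (p∈S' : In G S' p) (p<η : height p < η) (q-child : T (decChild p q))
    (S'-induced : Induced G S')
    (Tr-cross : ∀ u v → In G S' u → In G Tr v → ¬ In G S' v → Graph.Adj G u v → TEdge G Tr u v)
    where

    open Graph G using (Adj; irrefl) renaming (sym to Adj-sym)
    open DecChild (decChild⇒ q-child) public
      renaming (c∈Tr to q∈Tr; c∉S' to q∉S'; c≢r to q≢r; par≡y to parq≡p)

    S : RData G
    S = extend G S' p q

    S-cases : ∀ {v} → In G S v → In G S' v ⊎ v ≡ q
    S-cases {v} v∈S with ∨-elim (mem S' v) v∈S
    ... | inj₁ v∈S' = inj₁ v∈S'
    ... | inj₂ v≡q  = inj₂ (toWitness v≡q)

    S'⊆S : ∀ {v} → In G S' v → In G S v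
    S'⊆S {v} = ∨-introˡ ⌊ v ≟ q ⌋

    q∈S : In G S q
    q∈S = ∨-introʳ (mem S' q) (fromWitness refl)

    S'∌q : ∀ {v} → In G S' v → v ≢ q
    S'∌q v∈S' v≡q = q∉S' (subst (In G S') v≡q v∈S')

    q≢rS : q ≢ root S
    q≢rS q≡rS' = q≢r (trans q≡rS' rS'≡r)

    S-parent-q : par S q ≡ p
    S-parent-q with q ≟ q
    ... | yes _   = refl
    ... | no  q≢q = ⊥-elim (q≢q refl)

    S-parent-S' : ∀ {v} → v ≢ q → par S v ≡ par S' v
    S-parent-S' {v} v≢q with v ≟ q
    ... | yes v≡q = ⊥-elim (v≢q v≡q)
    ... | no  _   = refl

    q~p : Adj q p
    q~p = decChild⇒Adj q-child

    only-p~q : ∀ u → In G S' u → Adj u q → u ≡ p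
    only-p~q u u∈S' u~q with Tr-cross u q u∈S' q∈Tr q∉S' u~q
    ... | inj₁ (_ , u≢r , paru≡q) = ⊥-elim (q∉S' (subst (In G S') paru≡q (S'-parent u u∈S' u≢r)))
    ... | inj₂ (_ , _ , parq≡u)   = trans (sym parq≡u) parq≡p

    Ht-S'⇒S : ∀ {v h} → Ht G S' v h → Ht G S v h
    Ht-S'⇒S h0 = h0
    Ht-S'⇒S (hs v≢r v∈S' H) = hs v≢r (S'⊆S v∈S') (subst (λ x → Ht G S x _) (sym (S-parent-S' (S'∌q v∈S'))) (Ht-S'⇒S H))

    Ht-S⇒S' : ∀ {v h} → In G S' v → Ht G S v h → Ht G S' v h
    Ht-S⇒S' v∈S' h0 = h0
    Ht-S⇒S' {v} v∈S' (hs v≢r _ H) =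
      hs v≢r v∈S' (Ht-S⇒S' (parent-In S'-tree v v∈S' v≢r) (subst (λ x → Ht G S x _) (S-parent-S' (S'∌q v∈S')) H))

    Ht-S-q : Ht G S q (suc (height p))
    Ht-S-q = hs q≢rS q∈S (subst (λ x → Ht G S x _) (sym S-parent-q) (Ht-S'⇒S (Ht-height-S' p∈S')))

    S-tree : IsRTree G S
    S-tree = S'⊆S (proj₁ S'-tree) , heights , to-parent
      where
      heights : ∀ v → In G S v → ∃ (Ht G S v)
      heights v v∈S with S-cases v∈S
      ... | inj₁ v∈S' = height v , Ht-S'⇒S (Ht-height-S' v∈S')
      ... | inj₂ refl = suc (height p) , Ht-S-q
      to-parent : ∀ v → In G S v → v ≢ root S → Adj v (par S v)
      to-parent v v∈S v≢r with S-cases v∈S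
      ... | inj₁ v∈S' = subst (Adj v) (sym (S-parent-S' (S'∌q v∈S'))) (proj₂ (proj₂ S'-tree) v v∈S' v≢r)
      ... | inj₂ refl = subst (Adj q) (sym S-parent-q) q~p

    TEdge-S'⇒S : ∀ {u v} → TEdge G S' u v → TEdge G S u v
    TEdge-S'⇒S (inj₁ (u∈S' , u≢r , paru≡v)) = inj₁ (S'⊆S u∈S' , u≢r , trans (S-parent-S' (S'∌q u∈S')) paru≡v)
    TEdge-S'⇒S (inj₂ (v∈S' , v≢r , parv≡u)) = inj₂ (S'⊆S v∈S' , v≢r , trans (S-parent-S' (S'∌q v∈S')) parv≡u)

    S-induced : Induced G S
    S-induced u v u∈S v∈S u~v with S-cases u∈S | S-cases v∈S
    ... | inj₁ u∈S' | inj₁ v∈S' = TEdge-S'⇒S (S'-induced u v u∈S' v∈S' u~v)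
    ... | inj₁ u∈S' | inj₂ refl = inj₂ (q∈S , q≢rS , trans S-parent-q (sym (only-p~q u u∈S' u~v)))
    ... | inj₂ refl | inj₁ v∈S' = inj₁ (q∈S , q≢rS , trans S-parent-q (sym (only-p~q v v∈S' (Adj-sym u~v))))
    ... | inj₂ refl | inj₂ refl = ⊥-elim (irrefl u~v)

    S-height : HeightAtMost G S η
    S-height v h v∈S H with S-cases v∈S
    ... | inj₁ v∈S' = S'-height v h v∈S' (Ht-S⇒S' v∈S' H)
    ... | inj₂ refl rewrite Ht-unique H Ht-S-q = p<η

  module Overload (t ζ ε L : ℕ) (no-Ktt : ¬ ContainsKtt G t)
    (ζ≤ζ' : ζ ≤ ζ') (1≤ε : 1 ≤ ε) (t[ζ+ε]≤ζ' : t * (ζ + ε) ≤ ζ') (ζ'≤εL : 2 ≤ η → ζ' ≤ ε * L)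
    (t≤L : t ≤ L) (1≤L : 1 ≤ L)
    where

    open Graph G using (Adj; adj?; irrefl)

    mutual
      bad : ℕ → V G → V G → Bool
      bad d q c = ⌊ c ≟ q ⌋ ∨ (⌊ adj? q c ⌋ ∨ overloadedBelow d q c)

      overloadedBelow : ℕ → V G → V G → Bool
      overloadedBelow zero    q c = false
      overloadedBelow (suc d) q c = overloaded d q c

      overloaded : ℕ → V G → V G → Bool
      overloaded d q y = (ζ' ∸ ζ) <ᵇ count (λ c → decChild y c ∧ bad d q c)

    overloadedChildren : ℕ → V G → V G → ℕ
    overloadedChildren d q y = count (λ c → decChild y c ∧ overloadedBelow d q c)

    bad-children≤ : ∀ d q y → count (λ c → decChild y c ∧ bad d q c)
                              ≤ 1 + count (λ c → decChild y c ∧ ⌊ adj? q c ⌋) + overloadedChildren d q y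
    bad-children≤ d q y = begin
      count (λ c → C c ∧ bad d q c)
        ≤⟨ count-∧-∨ C (λ c → ⌊ c ≟ q ⌋) (λ c → ⌊ adj? q c ⌋ ∨ overloadedBelow d q c) ⟩
      count (λ c → C c ∧ ⌊ c ≟ q ⌋) + count (λ c → C c ∧ (⌊ adj? q c ⌋ ∨ overloadedBelow d q c))
        ≤⟨ +-mono-≤ (≤-trans (≤-reflexive (count-singleton C q)) (indicator≤1 (C q)))
                    (count-∧-∨ C (λ c → ⌊ adj? q c ⌋) (overloadedBelow d q)) ⟩
      1 + (count (λ c → C c ∧ ⌊ adj? q c ⌋) + overloadedChildren d q y)
        ≡⟨ +-assoc 1 (count (λ c → C c ∧ ⌊ adj? q c ⌋)) (overloadedChildren d q y) ⟨
      1 + count (λ c → C c ∧ ⌊ adj? q c ⌋) + overloadedChildren d q y ∎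
      where
      open ≤-Reasoning
      C = decChild y

    lightlyOverloaded : ℕ → V G → V G → Bool
    lightlyOverloaded d q y = overloaded d q y ∧ not (ε ≤ᵇ overloadedChildren d q y)

    non-neighbours< : ∀ d q y → In G Tr y → height y < η → T (lightlyOverloaded d q y) →
      count (λ c → decChild y c ∧ not ⌊ adj? q c ⌋) < ζ + ε
    non-neighbours< d q y y∈Tr y<η light = +-cancelˡ-< A _ _ (begin-strict
      A + N                ≡⟨ count-split (decChild y) (λ c → ⌊ adj? q c ⌋) ⟨
      count (decChild y)   ≡⟨ decChildren≡ζ' y∈Tr y<η ⟩
      ζ'                   ≡⟨ m+[n∸m]≡n ζ≤ζ' ⟨
      ζ + (ζ' ∸ ζ)         <⟨ +-monoʳ-< ζ (<ᵇ⇒< _ _ (∧-elimˡ (overloaded d q y) light)) ⟩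
      ζ + B                ≤⟨ +-monoʳ-≤ ζ (bad-children≤ d q y) ⟩
      ζ + (1 + A + M)      ≡⟨ cong (ζ +_) (+-suc A M) ⟨
      ζ + (A + suc M)      ≤⟨ +-monoʳ-≤ ζ (+-monoʳ-≤ A M<ε) ⟩
      ζ + (A + ε)          ≡⟨ solve 3 (λ ζ A ε → ζ :+ (A :+ ε) := A :+ (ζ :+ ε)) refl ζ A ε ⟩
      A + (ζ + ε)          ∎)
      where
      open ≤-Reasoning
      A = count (λ c → decChild y c ∧ ⌊ adj? q c ⌋)
      N = count (λ c → decChild y c ∧ not ⌊ adj? q c ⌋)
      B = count (λ c → decChild y c ∧ bad d q c)
      M = overloadedChildren d q y
      M<ε : M < ε
      M<ε = ≰⇒> (λ ε≤M → T-not⇒¬T (∧-elimʳ (overloaded d q y) light) (≤⇒≤ᵇ ε≤M))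

    lightlyOverloaded<t : ∀ d y → In G Tr y → height y < η → count (λ q → lightlyOverloaded d q y) < t
    lightlyOverloaded<t d y y∈Tr y<η with t ≤? count (λ q → lightlyOverloaded d q y)
    ... | no  t≰count = ≰⇒> t≰count
    ... | yes t≤count = contradiction (a , b , a-injective , b-injective , a≢b , a~b) no-Ktt
      where
      open ≤-Reasoning
      C = decChild y
      as = distinct-witnesses t (λ q → lightlyOverloaded d q y) t≤count
      a = proj₁ as
      a-injective = proj₁ (proj₂ as)
      adjacentToAll : V G → Bool
      adjacentToAll c = C c ∧ allᵇ (λ i → ⌊ adj? (a i) c ⌋)
      k = pred (ζ + ε)
      instance
        ζ+ε-nonZero : NonZero (ζ + ε)
        ζ+ε-nonZero = >-nonZero (≤-trans 1≤ε (m≤n+m ε ζ))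
      misses : ∀ i → count (λ c → C c ∧ not ⌊ adj? (a i) c ⌋) ≤ k
      misses i = <⇒≤pred (non-neighbours< d (a i) y y∈Tr y<η (proj₂ (proj₂ as) i))
      t≤common : t ≤ count adjacentToAll
      t≤common = +-cancelʳ-≤ (t * k) t (count adjacentToAll) (begin
        t + t * k                  ≡⟨ *-suc t k ⟨
        t * suc k                  ≡⟨ cong (t *_) (suc-pred (ζ + ε)) ⟩
        t * (ζ + ε)                ≤⟨ t[ζ+ε]≤ζ' ⟩
        ζ'                         ≡⟨ decChildren≡ζ' y∈Tr y<η ⟨
        count C                    ≤⟨ count-common C (λ i c → ⌊ adj? (a i) c ⌋) misses ⟩
        count adjacentToAll + t * k ∎)
      bs = distinct-witnesses t adjacentToAll t≤common
      b = proj₁ bs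
      b-injective = proj₁ (proj₂ bs)
      a~b : ∀ i j → Adj (a i) (b j)
      a~b i j = toWitness (T-allᵇ (λ i → ⌊ adj? (a i) (b j) ⌋) (∧-elimʳ (C (b j)) (proj₂ (proj₂ bs) j)) i)
      a≢b : ∀ i j → a i ≢ b j
      a≢b i j ai≡bj = irrefl (subst (Adj (a i)) (sym ai≡bj) (a~b i j))

    heavilyOverloaded : ℕ → V G → V G → Bool
    heavilyOverloaded d q y = overloaded d q y ∧ (ε ≤ᵇ overloadedChildren d q y)

    instance
      ε-nonZero : NonZero ε
      ε-nonZero = >-nonZero 1≤ε

    mutual
      overloaded<L^[1+d] : ∀ d y → In G Tr y → height y + suc d ≡ η →
        count (λ q → overloaded d q y) < L ^ suc d
      overloaded<L^[1+d] d y y∈Tr y+1+d≡η = begin-strict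
        count (λ q → overloaded d q y)
          ≡⟨ count-split (λ q → overloaded d q y) (λ q → ε ≤ᵇ overloadedChildren d q y) ⟩
        count (λ q → heavilyOverloaded d q y) + count (λ q → lightlyOverloaded d q y)
          <⟨ +-mono-≤-< (heavilyOverloaded≤ d y y∈Tr y+1+d≡η) (lightlyOverloaded<t d y y∈Tr y<η) ⟩
        L * pred (L ^ d) + t
          ≤⟨ +-monoʳ-≤ (L * pred (L ^ d)) t≤L ⟩
        L * pred (L ^ d) + L
          ≡⟨ +-comm (L * pred (L ^ d)) L ⟩
        L + L * pred (L ^ d)
          ≡⟨ *-suc L (pred (L ^ d)) ⟨
        L * suc (pred (L ^ d))
          ≡⟨ cong (L *_) (suc-pred (L ^ d) {{L^d-nonZero}}) ⟩
        L ^ suc d ∎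
        where
        open ≤-Reasoning
        y<η : height y < η
        y<η = subst (height y <_) y+1+d≡η (m<m+n (height y) z<s)
        L^d-nonZero : NonZero (L ^ d)
        L^d-nonZero = >-nonZero (1≤m^n d 1≤L)

      heavilyOverloaded≤ : ∀ d y → In G Tr y → height y + suc d ≡ η →
        count (λ q → heavilyOverloaded d q y) ≤ L * pred (L ^ d)
      heavilyOverloaded≤ zero y _ _ = ≤-trans (≤-reflexive (count-none _ not-heavy)) z≤n
        where
        not-heavy : ∀ q → ¬ T (heavilyOverloaded zero q y)
        not-heavy q heavy = <⇒≱ 1≤ε (≤-trans (≤ᵇ⇒≤ ε _ (∧-elimʳ (overloaded zero q y) heavy))
                                             (≤-reflexive (count-∧-false (decChild y))))
      heavilyOverloaded≤ (suc d) y y∈Tr y+2+d≡η = *-cancelʳ-≤ _ (L * P) ε (begin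
        count (λ q → heavilyOverloaded (suc d) q y) * ε
          ≤⟨ double-counting (λ q c → decChild y c ∧ overloaded d q c) (λ q → heavilyOverloaded (suc d) q y)
               (decChild y) rows columns (λ q c → ∧-elimˡ (decChild y c)) ⟩
        count (decChild y) * P
          ≡⟨ cong (_* P) (decChildren≡ζ' y∈Tr y<η) ⟩
        ζ' * P
          ≤⟨ *-monoˡ-≤ P (ζ'≤εL 2≤η) ⟩
        ε * L * P
          ≡⟨ solve 3 (λ ε L P → ε :* L :* P := L :* P :* ε) refl ε L P ⟩
        L * P * ε ∎)
        where
        open ≤-Reasoning
        P = pred (L ^ suc d)
        y<η : height y < η
        y<η = subst (height y <_) y+2+d≡η (m<m+n (height y) z<s)
        2≤η : 2 ≤ η
        2≤η = ≤-trans (s≤s (s≤s z≤n)) (≤-trans (m≤n+m (suc (suc d)) (height y)) (≤-reflexive y+2+d≡η))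
        rows : ∀ q → T (heavilyOverloaded (suc d) q y) → ε ≤ overloadedChildren (suc d) q y
        rows q heavy = ≤ᵇ⇒≤ ε _ (∧-elimʳ (overloaded (suc d) q y) heavy)
        columns : ∀ c → T (decChild y c) → count (λ q → decChild y c ∧ overloaded d q c) ≤ P
        columns c child = ≤-trans (count-mono {g = λ q → overloaded d q c} (λ q → ∧-elimʳ (decChild y c)))
          (<⇒≤pred (overloaded<L^[1+d] d c (DecChild.c∈Tr (decChild⇒ child))
            (trans (cong (_+ suc d) (height-decChild child)) (trans (sym (+-suc (height y) (suc d))) y+2+d≡η))))

    depth : V G → ℕ
    depth u = η ∸ suc (height u)

    height+1+depth≡η : ∀ {u} → height u < η → height u + suc (depth u) ≡ η
    height+1+depth≡η {u} u<η =
      trans (cong (height u +_) (sym (+-∸-assoc 1 u<η))) (m+[n∸m]≡n (<⇒≤ u<η))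

    overloadedAt : V G → V G → Bool
    overloadedAt q u = mem S' u ∧ (height u <ᵇ η) ∧ overloaded (depth u) q u

    spoilt : V G → Bool
    spoilt q = 0 <ᵇ count (overloadedAt q)

    spoilt-count≤ : count spoilt ≤ size G S' * pred (L ^ η)
    spoilt-count≤ = ≤-trans (≤-reflexive (sym (*-identityʳ (count spoilt))))
      (double-counting overloadedAt spoilt (mem S') (λ q s → <ᵇ⇒< 0 _ s) column (λ q u → ∧-elimˡ (mem S' u)))
      where
      column : ∀ u → In G S' u → count (λ q → overloadedAt q u) ≤ pred (L ^ η)
      column u u∈S' with height u <? η
      ... | no  u≮η = ≤-trans (≤-reflexive (count-none (λ q → overloadedAt q u) (λ q at → u≮η
                        (<ᵇ⇒< _ _ (∧-elimˡ (height u <ᵇ η) (∧-elimʳ (mem S' u) at)))))) z≤n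
      ... | yes u<η = <⇒≤pred (begin-strict
        count (λ q → overloadedAt q u)
          ≤⟨ count-mono {g = λ q → overloaded (depth u) q u}
               (λ q at → ∧-elimʳ (height u <ᵇ η) (∧-elimʳ (mem S' u) at)) ⟩
        count (λ q → overloaded (depth u) q u)
          <⟨ overloaded<L^[1+d] (depth u) u (S'⊆Tr-mem u u∈S') (height+1+depth≡η u<η) ⟩
        L ^ suc (depth u)
          ≤⟨ ^-monoʳ-≤′ 1≤L (≤-trans (≤-reflexive (sym (+-∸-assoc 1 u<η))) (m∸n≤m η (height u))) ⟩
        L ^ η ∎)
        where open ≤-Reasoning

    unspoilt-decChild : ∀ {p} → In G S' p → height p < η → size G S' * L ^ η ≤ ζ' →
      Σ (V G) λ q → T (decChild p q) × (∀ u → In G S' u → height u < η → ¬ T (overloaded (depth u) q u))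
    unspoilt-decChild {p} p∈S' p<η s*L^η≤ζ' with count>0⇒∃ (λ q → decChild p q ∧ not (spoilt q)) fresh>0
      where
      open ≤-Reasoning
      instance
        size-nonZero : NonZero (size G S')
        size-nonZero = >-nonZero (∃⇒count>0 (mem S') p p∈S')
      spoilt-children<ζ' : count (λ q → decChild p q ∧ spoilt q) < ζ'
      spoilt-children<ζ' = begin-strict
        count (λ q → decChild p q ∧ spoilt q) ≤⟨ count-mono (λ q → ∧-elimʳ (decChild p q)) ⟩
        count spoilt                          ≤⟨ spoilt-count≤ ⟩
        size G S' * pred (L ^ η)              <⟨ *-monoʳ-< (size G S') (pred[n]<n (1≤m^n η 1≤L)) ⟩
        size G S' * L ^ η                     ≤⟨ s*L^η≤ζ' ⟩
        ζ'                                    ∎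
      fresh>0 : 0 < count (λ q → decChild p q ∧ not (spoilt q))
      fresh>0 = +-cancelˡ-< (count (λ q → decChild p q ∧ spoilt q)) 0 _ (begin-strict
        count (λ q → decChild p q ∧ spoilt q) + 0 ≡⟨ +-identityʳ _ ⟩
        count (λ q → decChild p q ∧ spoilt q)     <⟨ spoilt-children<ζ' ⟩
        ζ'                                        ≡⟨ decChildren≡ζ' (S'⊆Tr-mem p p∈S') p<η ⟨
        count (decChild p)                        ≡⟨ count-split (decChild p) spoilt ⟩
        count (λ q → decChild p q ∧ spoilt q) + count (λ q → decChild p q ∧ not (spoilt q)) ∎)
    ... | q , fresh = q , ∧-elimˡ (decChild p q) fresh , not-overloaded
      where
      not-overloaded : ∀ u → In G S' u → height u < η → ¬ T (overloaded (depth u) q u)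
      not-overloaded u u∈S' u<η ov = T-not⇒¬T (∧-elimʳ (decChild p q) fresh)
        (<⇒<ᵇ (∃⇒count>0 (overloadedAt q) u (∧-intro {mem S' u} u∈S' (∧-intro {height u <ᵇ η} (<⇒<ᵇ u<η) ov))))

    module NewDecoration {p q : V G} (p∈S' : In G S' p) (p<η : height p < η) (q-child : T (decChild p q))
      (q-unspoilt : ∀ u → In G S' u → height u < η → ¬ T (overloaded (depth u) q u))
      (S'-induced : Induced G S') (Tr-paths : PathInduced G Tr)
      (Tr-cross : ∀ u v → In G S' u → In G Tr v → ¬ In G S' v → Graph.Adj G u v → TEdge G Tr u v)
      (1≤ζ : 1 ≤ ζ)
      where

      open Extension p∈S' p<η q-child S'-induced Tr-cross public

      -- The height of x bounds the number of parent steps to the root, so it serves as fuel.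
      belowQ′ : ℕ → V G → Bool
      belowQ′ zero    x = ⌊ x ≟ q ⌋
      belowQ′ (suc k) x = ⌊ x ≟ q ⌋ ∨ belowQ′ k (par Tr x)

      belowQ : V G → Bool
      belowQ x = belowQ′ (height x) x

      eligible : V G → Bool
      eligible x = belowQ (par Tr x) ∨ not (bad (η ∸ height x) q x)

      eligibleChild : V G → V G → Bool
      eligibleChild y w = decChild y w ∧ eligible w

      selectedChild : V G → V G → Bool
      selectedChild y w = eligibleChild y w ∧ (rank (eligibleChild y) w <ᵇ ζ)

      selected : V G → Bool
      selected w = selectedChild (par Tr w) w

      kept′ : ℕ → V G → Bool
      kept′ zero    x = mem S x
      kept′ (suc k) x = mem S x ∨ (selected x ∧ ((height x ≤ᵇ η) ∧ kept′ k (par Tr x)))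

      kept : V G → Bool
      kept x = kept′ (height x) x

      selected⇒decChild : ∀ {x} → T (selected x) → DecChild (par Tr x) x
      selected⇒decChild {x} sel = decChild⇒ (∧-elimˡ (decChild (par Tr x) x) (∧-elimˡ (eligibleChild (par Tr x) x) sel))

      record Added (x : V G) : Set where
        field
          is-selected  : T (selected x)
          height≤η     : height x ≤ η
          parent-kept  : T (kept (par Tr x))

      selected⇒eligible : ∀ {x} → T (selected x) → T (eligible x)
      selected⇒eligible {x} sel = ∧-elimʳ (decChild (par Tr x) x) (∧-elimˡ (eligibleChild (par Tr x) x) sel)

      height-selected : ∀ {x} → T (selected x) → height x ≡ suc (height (par Tr x))
      height-selected sel = height-parent c∈Tr c≢r
        where open DecChild (selected⇒decChild sel)

      kept-cases : ∀ x → T (kept x) → In G S x ⊎ Added x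
      kept-cases x = go (height x) refl
        where
        go : ∀ k → height x ≡ k → T (kept′ k x) → In G S x ⊎ Added x
        go zero    _ x∈S = inj₁ x∈S
        go (suc k) x≡1+k kx with ∨-elim (mem S x) kx
        ... | inj₁ x∈S = inj₁ x∈S
        ... | inj₂ new = inj₂ record
          { is-selected = sel
          ; height≤η    = ≤ᵇ⇒≤ _ _ (∧-elimˡ (height x ≤ᵇ η) rest)
          ; parent-kept = subst (λ k → T (kept′ k (par Tr x)))
                            (suc-injective (trans (sym x≡1+k) (height-selected sel)))
                            (∧-elimʳ (height x ≤ᵇ η) rest)
          }
          where
          sel = ∧-elimˡ (selected x) new
          rest = ∧-elimʳ (selected x) new

      Added⇒kept : ∀ x → Added x → T (kept x)
      Added⇒kept x new = subst (λ k → T (kept′ k x)) (sym (height-selected is-selected))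
        (∨-introʳ (mem S x) (∧-intro {selected x} is-selected (∧-intro {height x ≤ᵇ η} (≤⇒≤ᵇ height≤η) parent-kept)))
        where open Added new

      S⊆kept : ∀ x → In G S x → T (kept x)
      S⊆kept x x∈S with height x
      ... | zero  = x∈S
      ... | suc _ = ∨-introˡ _ x∈S

      kept⇒Tr : ∀ x → T (kept x) → In G Tr x
      kept⇒Tr x kx with kept-cases x kx
      ... | inj₂ new = DecChild.c∈Tr (selected⇒decChild (Added.is-selected new))
      ... | inj₁ x∈S with S-cases x∈S
      ...   | inj₁ x∈S' = S'⊆Tr-mem x x∈S'
      ...   | inj₂ refl = q∈Tr

      kept-parent : ∀ x → T (kept x) → x ≢ r → T (kept (par Tr x))
      kept-parent x kx x≢r with kept-cases x kx
      ... | inj₂ new = Added.parent-kept new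
      ... | inj₁ x∈S with S-cases x∈S
      ...   | inj₁ x∈S' = S⊆kept _ (S'⊆S (S'-parent x x∈S' x≢r))
      ...   | inj₂ refl = subst (λ y → T (kept y)) (sym parq≡p) (S⊆kept p (S'⊆S p∈S'))

      kept-height≤η : ∀ x → T (kept x) → height x ≤ η
      kept-height≤η x kx with kept-cases x kx
      ... | inj₂ new = Added.height≤η new
      ... | inj₁ x∈S with S-cases x∈S
      ...   | inj₁ x∈S' = height-S'≤η x∈S'
      ...   | inj₂ refl = subst (_≤ η) (sym (height-decChild q-child)) p<η

      Tr' : RData G
      Tr' = mkR r kept (par Tr)

      Ht-Tr⇒Tr' : ∀ {v h} → T (kept v) → Ht G Tr v h → Ht G Tr' v h
      Ht-Tr⇒Tr' kv h0                  = h0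
      Ht-Tr⇒Tr' {v} kv (hs v≢r v∈Tr H) = hs v≢r kv (Ht-Tr⇒Tr' (kept-parent v kv v≢r) H)

      Tr'-tree : IsRTree G Tr'
      Tr'-tree = S⊆kept r (S'⊆S r∈S') ,
                 (λ v kv → height v , Ht-Tr⇒Tr' kv (Ht-height (kept⇒Tr v kv))) ,
                 (λ v kv v≢r → proj₂ (proj₂ Tr-tree) v (kept⇒Tr v kv) v≢r)

      S⊆Tr' : Subtree G S Tr'
      S⊆Tr' = rS'≡r , S⊆kept , parents
        where
        parents : ∀ v → In G S v → v ≢ root S → par S v ≡ par Tr v
        parents v v∈S v≢r with S-cases v∈S
        ... | inj₁ v∈S' = trans (S-parent-S' (S'∌q v∈S')) (proj₂ (proj₂ S'⊆Tr) v v∈S' v≢r)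
        ... | inj₂ refl = trans S-parent-q (sym parq≡p)

      Tr'⊆Tr : Subtree G Tr' Tr
      Tr'⊆Tr = refl , kept⇒Tr , (λ _ _ _ → refl)

      Anc-Tr'⇒Tr : ∀ {a w} → Anc G Tr' a w → Anc G Tr a w
      Anc-Tr'⇒Tr here                  = here
      Anc-Tr'⇒Tr (up {w} kw w≢r A) = up (kept⇒Tr w kw) w≢r (Anc-Tr'⇒Tr A)

      Anc-kept : ∀ {a w} → T (kept w) → Anc G Tr' a w → T (kept a)
      Anc-kept kw here                 = kw
      Anc-kept kw (up {w} _ w≢r A) = Anc-kept (kept-parent w kw w≢r) A

      TEdge-Tr⇒Tr' : ∀ {a b} → T (kept a) → T (kept b) → TEdge G Tr a b → TEdge G Tr' a b
      TEdge-Tr⇒Tr' ka _  (inj₁ (_ , a≢r , para≡b)) = inj₁ (ka , a≢r , para≡b)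
      TEdge-Tr⇒Tr' _  kb (inj₂ (_ , b≢r , parb≡a)) = inj₂ (kb , b≢r , parb≡a)

      Tr'-paths : PathInduced G Tr'
      Tr'-paths w a b kw Aa Ab a~b = TEdge-Tr⇒Tr' (Anc-kept kw Aa) (Anc-kept kw Ab)
        (Tr-paths w a b (kept⇒Tr w kw) (Anc-Tr'⇒Tr Aa) (Anc-Tr'⇒Tr Ab) a~b)

      belowQ⇒Anc : ∀ x → In G Tr x → T (belowQ x) → Anc G Tr q x
      belowQ⇒Anc x x∈Tr = go (height x) refl x∈Tr
        where
        go : ∀ k {x} → height x ≡ k → In G Tr x → T (belowQ′ k x) → Anc G Tr q x
        go zero    _ _ x≡q = subst (Anc G Tr q) (sym (toWitness x≡q)) here
        go (suc k) {x} x≡1+k x∈Tr below with ∨-elim ⌊ x ≟ q ⌋ below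
        ... | inj₁ x≡q = subst (Anc G Tr q) (sym (toWitness x≡q)) here
        ... | inj₂ parent-below = up x∈Tr x≢r
          (go k (suc-injective (trans (sym (height-parent x∈Tr x≢r)) x≡1+k)) (parent-In Tr-tree x x∈Tr x≢r) parent-below)
          where
          x≢r : x ≢ r
          x≢r refl = 0≢1+n (trans (sym (height-Ht h0)) x≡1+k)

      adj⇒bad : ∀ d v → Adj q v → T (bad d q v)
      adj⇒bad d v q~v = ∨-introʳ ⌊ v ≟ q ⌋ (∨-introˡ (overloadedBelow d q v) (fromWitness {a? = adj? q v} q~v))

      Tr'-cross : ∀ u v → In G S u → In G Tr' v → ¬ In G S v → Adj u v → TEdge G Tr' u v
      Tr'-cross u v u∈S kv v∉S u~v with S-cases u∈S
      ... | inj₁ u∈S' = TEdge-Tr⇒Tr' (S⊆kept u u∈S) kv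
                          (Tr-cross u v u∈S' (kept⇒Tr v kv) (λ v∈S' → v∉S (S'⊆S v∈S')) u~v)
      ... | inj₂ refl with kept-cases v kv
      ...   | inj₁ v∈S = ⊥-elim (v∉S v∈S)
      ...   | inj₂ new with ∨-elim (belowQ (par Tr v)) (selected⇒eligible (Added.is-selected new))
      ...     | inj₂ not-bad = ⊥-elim (T-not⇒¬T not-bad (adj⇒bad (η ∸ height v) v u~v))
      ...     | inj₁ parent-below = TEdge-Tr⇒Tr' (S⊆kept q q∈S) kv
                  (Tr-paths v q v c∈Tr (up c∈Tr c≢r (belowQ⇒Anc (par Tr v) (parent-In Tr-tree v c∈Tr c≢r) parent-below)) here u~v)
        where open DecChild (selected⇒decChild (Added.is-selected new))

      Anc-S' : ∀ {a x} → In G S' x → Anc G Tr a x → In G S' a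
      Anc-S' x∈S' here                 = x∈S'
      Anc-S' x∈S' (up {x} _ x≢r A) = Anc-S' (S'-parent x x∈S' x≢r) A

      S'∌belowQ : ∀ x → In G S' x → ¬ T (belowQ x)
      S'∌belowQ x x∈S' below = q∉S' (Anc-S' x∈S' (belowQ⇒Anc x (S'⊆Tr-mem x x∈S') below))

      belowQ-q : T (belowQ q)
      belowQ-q with height q
      ... | zero  = fromWitness refl
      ... | suc _ = ∨-introˡ _ (fromWitness {a? = q ≟ q} refl)

      belowQ-child : ∀ x → In G Tr x → x ≢ r → T (belowQ (par Tr x)) → T (belowQ x)
      belowQ-child x x∈Tr x≢r parent-below =
        subst (λ k → T (belowQ′ k x)) (sym (height-parent x∈Tr x≢r)) (∨-introʳ ⌊ x ≟ q ⌋ parent-below)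

      ¬eligible-q : ¬ T (eligible q)
      ¬eligible-q el with ∨-elim (belowQ (par Tr q)) el
      ... | inj₁ p-below = S'∌belowQ p p∈S' (subst (λ y → T (belowQ y)) parq≡p p-below)
      ... | inj₂ not-bad = T-not⇒¬T not-bad (∨-introˡ _ (fromWitness {a? = q ≟ q} refl))

      not-overloaded : ∀ u → T (kept u) → height u < η → ¬ T (belowQ u) → ¬ T (overloaded (depth u) q u)
      not-overloaded u ku u<η u-not-below with kept-cases u ku
      ... | inj₁ u∈S with S-cases u∈S
      ...   | inj₁ u∈S' = q-unspoilt u u∈S' u<η
      ...   | inj₂ refl = ⊥-elim (u-not-below belowQ-q)
      not-overloaded u ku u<η u-not-below | inj₂ new
        with ∨-elim (belowQ (par Tr u)) (selected⇒eligible (Added.is-selected new))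
      ... | inj₁ parent-below = ⊥-elim (u-not-below (belowQ-child u c∈Tr c≢r parent-below))
        where open DecChild (selected⇒decChild (Added.is-selected new))
      ... | inj₂ not-bad = λ ov → T-not⇒¬T not-bad
              (subst (λ d → T (bad d q u)) (sym (+-∸-assoc 1 u<η))
                (∨-introʳ ⌊ u ≟ q ⌋ (∨-introʳ ⌊ adj? q u ⌋ ov)))

      ζ≤eligibleChildren : ∀ u → T (kept u) → height u < η → ζ ≤ count (eligibleChild u)
      ζ≤eligibleChildren u ku u<η with belowQ u in u-below?
      ... | true = begin
        ζ                       ≤⟨ ζ≤ζ' ⟩
        ζ'                      ≡⟨ decChildren≡ζ' (kept⇒Tr u ku) u<η ⟨
        count (decChild u)      ≤⟨ count-mono child⇒eligible ⟩
        count (eligibleChild u) ∎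
        where
        open ≤-Reasoning
        child⇒eligible : ∀ w → T (decChild u w) → T (eligibleChild u w)
        child⇒eligible w child = ∧-intro {decChild u w} child (∨-introˡ _
          (subst (λ y → T (belowQ y)) (sym (DecChild.par≡y (decChild⇒ child))) (subst T (sym u-below?) tt)))
      ... | false = +-cancelˡ-≤ B _ _ (begin
        B + ζ                                       ≤⟨ +-monoˡ-≤ ζ B≤ζ'∸ζ ⟩
        ζ' ∸ ζ + ζ                                  ≡⟨ m∸n+n≡m ζ≤ζ' ⟩
        ζ'                                          ≡⟨ decChildren≡ζ' (kept⇒Tr u ku) u<η ⟨
        count (decChild u)                          ≡⟨ count-split (decChild u) (bad (depth u) q) ⟩
        B + count (λ w → decChild u w ∧ not (bad (depth u) q w))
                                                    ≤⟨ +-monoʳ-≤ B (count-mono good⇒eligible) ⟩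
        B + count (eligibleChild u)                 ∎)
        where
        open ≤-Reasoning
        B = count (λ w → decChild u w ∧ bad (depth u) q w)
        B≤ζ'∸ζ : B ≤ ζ' ∸ ζ
        B≤ζ'∸ζ = ≮⇒≥ (λ ov → not-overloaded u ku u<η (subst T u-below?) (<⇒<ᵇ ov))
        good⇒eligible : ∀ w → T (decChild u w ∧ not (bad (depth u) q w)) → T (eligibleChild u w)
        good⇒eligible w good = ∧-intro {decChild u w} child (∨-introʳ (belowQ (par Tr w))
          (subst (λ d → T (not (bad d q w))) (sym (cong (η ∸_) (height-decChild child))) (∧-elimʳ (decChild u w) good)))
          where child = ∧-elimˡ (decChild u w) good

      Tr'-decChild : V G → V G → Bool
      Tr'-decChild u w = kept w ∧ not (mem S w) ∧ not ⌊ w ≟ r ⌋ ∧ ⌊ par Tr w ≟ u ⌋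

      Tr'-decChild≡ : ∀ u w → T (kept u) →
        Tr'-decChild u w ≡ selectedChild u w ∧ (height u <ᵇ η)
      Tr'-decChild≡ u w ku = T⇔T⇒≡ forth back
        where
        forth : T (Tr'-decChild u w) → T (selectedChild u w ∧ (height u <ᵇ η))
        forth new-child with kept-cases w kw
          where kw = ∧-elimˡ (kept w) new-child
        ... | inj₁ w∈S = ⊥-elim (T-not⇒¬T (∧-elimˡ (not (mem S w)) (∧-elimʳ (kept w) new-child)) w∈S)
        ... | inj₂ new = ∧-intro {selectedChild u w} (subst (λ y → T (selectedChild y w)) parw≡u is-selected)
            (<⇒<ᵇ (subst (_≤ η) (trans (height-selected is-selected) (cong (λ y → suc (height y)) parw≡u)) height≤η))
          where
          open Added new
          parw≡u : par Tr w ≡ u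
          parw≡u = toWitness (∧-elimʳ (not ⌊ w ≟ r ⌋) (∧-elimʳ (not (mem S w)) (∧-elimʳ (kept w) new-child)))
        back : T (selectedChild u w ∧ (height u <ᵇ η)) → T (Tr'-decChild u w)
        back sel∧u<η = ∧-intro {kept w} (Added⇒kept w new)
                         (∧-intro {not (mem S w)} (¬T⇒T-not w∉S) (∧-intro {not ⌊ w ≟ r ⌋} (fromWitnessFalse c≢r) (fromWitness par≡y)))
          where
          sel = ∧-elimˡ (selectedChild u w) sel∧u<η
          child = ∧-elimˡ (decChild u w) (∧-elimˡ (eligibleChild u w) sel)
          open DecChild (decChild⇒ child)
          new : Added w
          new = record
            { is-selected = subst (λ y → T (selectedChild y w)) (sym par≡y) sel
            ; height≤η    = subst (_≤ η) (sym (height-decChild child)) (<ᵇ⇒< _ _ (∧-elimʳ (selectedChild u w) sel∧u<η))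
            ; parent-kept = subst (λ y → T (kept y)) (sym par≡y) ku
            }
          w∉S : ¬ In G S w
          w∉S w∈S with S-cases w∈S
          ... | inj₁ w∈S' = c∉S' w∈S'
          ... | inj₂ refl = ¬eligible-q (∧-elimʳ (decChild u q) (∧-elimˡ (eligibleChild u q) sel))

      Tr'-decChildren : ∀ u → T (kept u) → decChildren G S Tr' u ≡ (if height u <ᵇ η then ζ else 0)
      Tr'-decChildren u ku = trans (count-cong (λ w → Tr'-decChild≡ u w ku)) (by-height (height u <ᵇ η) refl)
        where
        by-height : ∀ b → (height u <ᵇ η) ≡ b → count (λ w → selectedChild u w ∧ b) ≡ (if b then ζ else 0)
        by-height false _ = count-∧-false (selectedChild u)
        by-height true  u<η = begin
          count (λ w → selectedChild u w ∧ true) ≡⟨ count-cong (λ w → ∧-identityʳ (selectedChild u w)) ⟩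
          count (selectedChild u)
            ≡⟨ count-rank< (eligibleChild u) ζ ⟩
          ζ ⊓ count (eligibleChild u)
            ≡⟨ m≤n⇒m⊓n≡m (ζ≤eligibleChildren u ku (<ᵇ⇒< _ _ (subst T (sym u<η) tt))) ⟩
          ζ ∎
          where open ≡-Reasoning

      Tr'-uniform : ∀ v h → In G S v → Ht G S v h → DecUniform G S Tr' v ζ (η ∸ h)
      Tr'-uniform v h v∈S Hv u j D = by-height (height u <ᵇ η) refl
        where
        Hu = DHt-Ht (Subtree-Ht S⊆Tr' Hv) D
        ku = Ht-In {D = Tr'} (S⊆kept r (S'⊆S r∈S')) Hu
        children : ∀ {b} → (height u <ᵇ η) ≡ b → decChildren G S Tr' u ≡ (if b then ζ else 0)
        children u<η? = trans (Tr'-decChildren u ku) (cong (if_then ζ else 0) u<η?)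
        by-height : ∀ b → (height u <ᵇ η) ≡ b →
          (decChildren G S Tr' u ≢ 0 → decChildren G S Tr' u ≡ ζ) × (decChildren G S Tr' u ≡ 0 → j ≡ η ∸ h)
        by-height true  u<η = (λ _ → children u<η) , (λ none → ⊥-elim (<⇒≢ 1≤ζ (sym (trans (sym (children u<η)) none))))
        by-height false u≮η = (λ some → ⊥-elim (some (children u≮η))) , (λ _ → leaf-depth)
          where
          u≡h+j : height u ≡ h + j
          u≡h+j = height-Ht (Subtree-Ht Tr'⊆Tr Hu)
          leaf-depth : j ≡ η ∸ h
          leaf-depth = trans (sym (m+n∸m≡n h j)) (cong (_∸ h) (≤-antisym
            (subst (_≤ η) u≡h+j (kept-height≤η u ku))
            (subst (η ≤_) u≡h+j (≮⇒≥ (λ u<η → subst T u≮η (<⇒<ᵇ u<η))))))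

      decorated : Decorated G ζ η S
      decorated = S-tree , S-induced , S-height , Tr' , Tr'-tree , S⊆Tr' , Tr'-paths , Tr'-cross , Tr'-uniform

mainTheorem6 :
    (η t ζ ζ' : ℕ) → 1 ≤ η → 1 ≤ t → 2 ≤ ζ →
    (G : Graph) → ¬ ContainsKtt G t →
    (S' : RData G) → Decorated G ζ' η S' →
    ζ ^ η * size G S' * t ^ (η + 1) ≤ ζ' →
    (p : V G) → In G S' p → (hp : ℕ) → Ht G S' p hp → hp < η →
    Σ (V G) λ q →
      Graph.Adj G p q × ¬ In G S' q ×
      (∀ u → In G S' u → Graph.Adj G u q → u ≡ p) ×
      Decorated G ζ η (extend G S' p q)
mainTheorem6 η t ζ ζ' 1≤η 1≤t 2≤ζ G no-Ktt S'
  (S'-tree , S'-induced , S'-height , Tr , Tr-tree , S'⊆Tr , Tr-paths , Tr-cross , uniform)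
  bound p p∈S' hp Hp hp<η = q , Graph.sym G q~p , q∉S' , only-p~q , decorated
  where
  open Decoration G η ζ' S' Tr S'-tree S'-height Tr-tree S'⊆Tr uniform
  open ParameterBounds 2≤ζ 1≤t (∃⇒count>0 (mem S') p p∈S') 1≤η bound
  p<η : height p < η
  p<η = subst (_< η) (sym (height-S' Hp)) hp<η
  2≤t : 2 ≤ t
  2≤t = ≤∧≢⇒< 1≤t λ 1≡t → no-Ktt (subst (ContainsKtt G) 1≡t
          (edge⇒K₁₁ {G} (decChild⇒Adj (proj₂ (decChild-exists (S'⊆Tr-mem p p∈S') p<η 1≤ζ')))))
  open Slack (slack 2≤t)
  open Overload t ζ ε L no-Ktt ζ≤ζ' 1≤ε t[ζ+ε]≤ζ' ζ'≤εL t≤L (≤-trans 1≤t t≤L)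
  q-choice = unspoilt-decChild p∈S' p<η s*L^η≤ζ'
  q = proj₁ q-choice
  open NewDecoration p∈S' p<η (proj₁ (proj₂ q-choice)) (proj₂ (proj₂ q-choice)) S'-induced Tr-paths Tr-cross 1≤ζ
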